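{- Every PBZ*-lattice whose lattice order is linear belongs to $\mathbb{V}_3=\mathrm{Mod}(\mathrm{Eq}(\mathbb{AOL})\cup\{\mathrm{DIST},\mathrm{SDM}\})$, where (DIST) is $x\wedge(y\vee z)\approx(x\wedge y)\vee(x\wedge z)$ and (SDM) is $(x\wedge y)^{\sim}\approx x^{\sim}\vee y^{\sim}$.
   Context: A bounded involution lattice is a bounded lattice with an order-reversing involution $'$; it is a pseudo-Kleene algebra if $a\wedge a'\leq b\vee b'$ for all $a,b$. A BZ-lattice is an algebra $\langle B,\wedge,\vee,',^{\sim},0,1\rangle$ whose $^{\sim}$-free reduct is a pseudo-Kleene algebra and which satisfies: $a\wedge a^{\sim}=0$; $a\leq a^{\sim\sim}$; $a\leq b$ implies $b^{\sim}\leq a^{\sim}$; $a^{\sim\prime}=a^{\sim\sim}$. Write $\Diamond x=x^{\sim\sim}$. A PBZ*-lattice is a BZ-lattice satisfying $(a\wedge a')^{\sim}\leq a^{\sim}\vee a'^{\sim}$ and $(a^{\sim}\vee(\Diamond a\wedge\Diamond b))\wedge\Diamond a\leq\Diamond b$. An antiortholattice is a PBZ*-lattice whose only elements $a$ with $a\wedge a'=0$ are $0$ and $1$; $\mathrm{Eq}(\mathbb{AOL})$ is the set of identities valid in all antiortholattices, and $\mathrm{Mod}(\Sigma)$ the class of algebras satisfying $\Sigma$. -}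

module Defs where

open import Data.Nat using (ℕ)
open import Data.Sum using (_⊎_)
open import Data.Product using (_×_)
open import Relation.Binary.PropositionalEquality using (_≡_)

record BZLattice : Set₁ where
  infixr 7 _∧_
  infixr 6 _∨_
  field
    Carrier : Set
    _∧_ _∨_ : Carrier → Carrier → Carrier
    _′ _~ : Carrier → Carrier
    𝟘 𝟙 : Carrier

  _≤_ : Carrier → Carrier → Set
  a ≤ b = a ∧ b ≡ a

  ◇ : Carrier → Carrier
  ◇ a = (a ~) ~

  field
    ∧-assoc : ∀ a b c → (a ∧ b) ∧ c ≡ a ∧ (b ∧ c)
    ∨-assoc : ∀ a b c → (a ∨ b) ∨ c ≡ a ∨ (b ∨ c)
    ∧-comm  : ∀ a b → a ∧ b ≡ b ∧ a
    ∨-comm  : ∀ a b → a ∨ b ≡ b ∨ a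
    ∧-absorbs-∨ : ∀ a b → a ∧ (a ∨ b) ≡ a
    ∨-absorbs-∧ : ∀ a b → a ∨ (a ∧ b) ≡ a
    𝟘-least    : ∀ a → 𝟘 ≤ a
    𝟙-greatest : ∀ a → a ≤ 𝟙
    ′-invol   : ∀ a → (a ′) ′ ≡ a
    ′-antitone : ∀ a b → a ≤ b → (b ′) ≤ (a ′)
    pseudoKleene : ∀ a b → (a ∧ (a ′)) ≤ (b ∨ (b ′))
    ~-compl   : ∀ a → a ∧ (a ~) ≡ 𝟘
    ~-infl    : ∀ a → a ≤ ((a ~) ~)
    ~-antitone : ∀ a b → a ≤ b → (b ~) ≤ (a ~)
    ~′        : ∀ a → (a ~) ′ ≡ (a ~) ~

record PBZStarLattice : Set₁ where
  field
    bz : BZLattice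
  open BZLattice bz
  field
    star : ∀ a → ((a ∧ (a ′)) ~) ≤ ((a ~) ∨ ((a ′) ~))
    pbz  : ∀ a b → (((a ~) ∨ (◇ a ∧ ◇ b)) ∧ ◇ a) ≤ ◇ b

record Antiortholattice : Set₁ where
  field
    pbzstar : PBZStarLattice
  open BZLattice (PBZStarLattice.bz pbzstar)
  field
    aol : ∀ a → a ∧ (a ′) ≡ 𝟘 → (a ≡ 𝟘) ⊎ (a ≡ 𝟙)

data Term : Set where
  var  : ℕ → Term
  _∧ₜ_ _∨ₜ_ : Term → Term → Term
  _′ₜ _~ₜ : Term → Term
  𝟘ₜ 𝟙ₜ : Term

module _ (L : PBZStarLattice) where
  open BZLattice (PBZStarLattice.bz L)

  ⟦_⟧ : Term → (ℕ → Carrier) → Carrier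
  ⟦ var i ⟧ ρ = ρ i
  ⟦ s ∧ₜ t ⟧ ρ = ⟦ s ⟧ ρ ∧ ⟦ t ⟧ ρ
  ⟦ s ∨ₜ t ⟧ ρ = ⟦ s ⟧ ρ ∨ ⟦ t ⟧ ρ
  ⟦ s ′ₜ ⟧ ρ = (⟦ s ⟧ ρ) ′
  ⟦ s ~ₜ ⟧ ρ = (⟦ s ⟧ ρ) ~
  ⟦ 𝟘ₜ ⟧ ρ = 𝟘
  ⟦ 𝟙ₜ ⟧ ρ = 𝟙

  Satisfies : Term → Term → Set
  Satisfies s t = ∀ (ρ : ℕ → Carrier) → ⟦ s ⟧ ρ ≡ ⟦ t ⟧ ρ

  Linear : Set
  Linear = ∀ a b → (a ≤ b) ⊎ (b ≤ a)

  DIST : Set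
  DIST = ∀ x y z → x ∧ (y ∨ z) ≡ (x ∧ y) ∨ (x ∧ z)

  SDM : Set
  SDM = ∀ x y → (x ∧ y) ~ ≡ (x ~) ∨ (y ~)

EqAOL : Term → Term → Set₁
EqAOL s t = ∀ (A : Antiortholattice) → Satisfies (Antiortholattice.pbzstar A) s t

InV3 : PBZStarLattice → Set₁
InV3 L = (∀ s t → EqAOL s t → Satisfies L s t) × DIST L × SDM L

module Submission where

-- The key observation is that L is then itself an antiortholattice:
-- if a ∧ a′ = 0, comparing a with a′ gives either a = 0 (when a ≤ a′)
-- or a′ = 0 and hence a = 1 (when a′ ≤ a).  So every identity valid in
-- all antiortholattices holds in L simply by instantiating it at L.
--
-- DIST and SDM follow from two facts valid in every BZ-lattice for a
-- comparable pair y ≤ z: the meet distributes over y ∨ z, and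
-- (y ∧ z)~ = y~ ∨ z~.  Linearity makes every pair comparable.

open import Defs
open import Data.Sum using (_⊎_; inj₁; inj₂)
open import Data.Product using (_,_)
open import Relation.Binary.PropositionalEquality
open ≡-Reasoning

module BZFacts (B : BZLattice) where
  open BZLattice B

  ∧-idem : ∀ a → a ∧ a ≡ a
  ∧-idem a = begin
    a ∧ a                ≡⟨ cong (a ∧_) (sym (∨-absorbs-∧ a a)) ⟩
    a ∧ (a ∨ (a ∧ a))    ≡⟨ ∧-absorbs-∨ a (a ∧ a) ⟩
    a                    ∎

  ≤⇒∨≡ʳ : ∀ {a b} → a ≤ b → a ∨ b ≡ b
  ≤⇒∨≡ʳ {a} {b} a≤b = begin
    a ∨ b          ≡⟨ cong (_∨ b) (sym a≤b) ⟩
    (a ∧ b) ∨ b    ≡⟨ ∨-comm (a ∧ b) b ⟩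
    b ∨ (a ∧ b)    ≡⟨ cong (b ∨_) (∧-comm a b) ⟩
    b ∨ (b ∧ a)    ≡⟨ ∨-absorbs-∧ b a ⟩
    b              ∎

  ≤⇒∨≡ˡ : ∀ {a b} → b ≤ a → a ∨ b ≡ a
  ≤⇒∨≡ˡ {a} {b} b≤a = trans (∨-comm a b) (≤⇒∨≡ʳ b≤a)

  ∧-monoʳ : ∀ x {y z} → y ≤ z → (x ∧ y) ≤ (x ∧ z)
  ∧-monoʳ x {y} {z} y≤z = begin
    (x ∧ y) ∧ (x ∧ z)    ≡⟨ sym (∧-assoc (x ∧ y) x z) ⟩
    ((x ∧ y) ∧ x) ∧ z    ≡⟨ cong (_∧ z) xy∧x≡xy ⟩
    (x ∧ y) ∧ z          ≡⟨ ∧-assoc x y z ⟩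
    x ∧ (y ∧ z)          ≡⟨ cong (x ∧_) y≤z ⟩
    x ∧ y                ∎
    where
    xy∧x≡xy : (x ∧ y) ∧ x ≡ x ∧ y
    xy∧x≡xy = begin
      (x ∧ y) ∧ x    ≡⟨ ∧-comm (x ∧ y) x ⟩
      x ∧ (x ∧ y)    ≡⟨ sym (∧-assoc x x y) ⟩
      (x ∧ x) ∧ y    ≡⟨ cong (_∧ y) (∧-idem x) ⟩
      x ∧ y          ∎

  dist-comparable : ∀ x {y z} → y ≤ z → x ∧ (y ∨ z) ≡ (x ∧ y) ∨ (x ∧ z)
  dist-comparable x {y} {z} y≤z = begin
    x ∧ (y ∨ z)          ≡⟨ cong (x ∧_) (≤⇒∨≡ʳ y≤z) ⟩
    x ∧ z                ≡⟨ sym (≤⇒∨≡ʳ (∧-monoʳ x y≤z)) ⟩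
    (x ∧ y) ∨ (x ∧ z)    ∎

  sdm-comparable : ∀ {x y} → x ≤ y → (x ∧ y) ~ ≡ (x ~) ∨ (y ~)
  sdm-comparable {x} {y} x≤y = begin
    (x ∧ y) ~        ≡⟨ cong _~ x≤y ⟩
    x ~              ≡⟨ sym (≤⇒∨≡ˡ (~-antitone x y x≤y)) ⟩
    (x ~) ∨ (y ~)    ∎

  𝟘′≡𝟙 : 𝟘 ′ ≡ 𝟙
  𝟘′≡𝟙 = begin
    𝟘 ′              ≡⟨ sym (𝟙-greatest (𝟘 ′)) ⟩
    𝟘 ′ ∧ 𝟙          ≡⟨ ∧-comm (𝟘 ′) 𝟙 ⟩
    𝟙 ∧ 𝟘 ′          ≡⟨ cong (_∧ 𝟘 ′) (sym (′-invol 𝟙)) ⟩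
    (𝟙 ′) ′ ∧ 𝟘 ′    ≡⟨ ′-antitone 𝟘 (𝟙 ′) (𝟘-least (𝟙 ′)) ⟩
    (𝟙 ′) ′          ≡⟨ ′-invol 𝟙 ⟩
    𝟙                ∎

  disjoint-below-compl : ∀ {a} → a ∧ a ′ ≡ 𝟘 → a ≤ (a ′) → a ≡ 𝟘
  disjoint-below-compl {a} disj a≤a′ = trans (sym a≤a′) disj

  disjoint-above-compl : ∀ {a} → a ∧ a ′ ≡ 𝟘 → (a ′) ≤ a → a ≡ 𝟙
  disjoint-above-compl {a} disj a′≤a = begin
    a            ≡⟨ sym (′-invol a) ⟩
    (a ′) ′      ≡⟨ cong _′ a′≡𝟘 ⟩
    𝟘 ′          ≡⟨ 𝟘′≡𝟙 ⟩
    𝟙            ∎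
    where
    a′≡𝟘 : a ′ ≡ 𝟘
    a′≡𝟘 = begin
      a ′          ≡⟨ sym a′≤a ⟩
      a ′ ∧ a      ≡⟨ ∧-comm (a ′) a ⟩
      a ∧ a ′      ≡⟨ disj ⟩
      𝟘            ∎

module Chain (L : PBZStarLattice) (lin : Linear L) where
  open PBZStarLattice L
  open BZLattice bz
  open BZFacts bz

  dist : DIST L
  dist x y z with lin y z
  ... | inj₁ y≤z = dist-comparable x y≤z
  ... | inj₂ z≤y = begin
    x ∧ (y ∨ z)          ≡⟨ cong (x ∧_) (∨-comm y z) ⟩
    x ∧ (z ∨ y)          ≡⟨ dist-comparable x z≤y ⟩
    (x ∧ z) ∨ (x ∧ y)    ≡⟨ ∨-comm (x ∧ z) (x ∧ y) ⟩
    (x ∧ y) ∨ (x ∧ z)    ∎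

  sdm : SDM L
  sdm x y with lin x y
  ... | inj₁ x≤y = sdm-comparable x≤y
  ... | inj₂ y≤x = begin
    (x ∧ y) ~        ≡⟨ cong _~ (∧-comm x y) ⟩
    (y ∧ x) ~        ≡⟨ sdm-comparable y≤x ⟩
    (y ~) ∨ (x ~)    ≡⟨ ∨-comm (y ~) (x ~) ⟩
    (x ~) ∨ (y ~)    ∎

  antiortholattice : Antiortholattice
  antiortholattice = record { pbzstar = L ; aol = only-trivial-disjoint }
    where
    only-trivial-disjoint : ∀ a → a ∧ a ′ ≡ 𝟘 → (a ≡ 𝟘) ⊎ (a ≡ 𝟙)
    only-trivial-disjoint a disj with lin a (a ′)
    ... | inj₁ a≤a′ = inj₁ (disjoint-below-compl disj a≤a′)
    ... | inj₂ a′≤a = inj₂ (disjoint-above-compl disj a′≤a)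

mainTheorem6 : (L : PBZStarLattice) → Linear L → InV3 L
mainTheorem6 L lin = aol-identities , dist , sdm
  where
  open Chain L lin

  aol-identities : ∀ s t → EqAOL s t → Satisfies L s t
  aol-identities s t valid = valid antiortholattice
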